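{- Let $k\ge 5$ be an integer and let $G$ be a 3-regular graph. Let $G'$ be the graph obtained from $G$ by attaching $k-5$ new leaf vertices (pendant vertices of degree 1) to each vertex of $G$. Then $G'$ has maximum degree $k-2$. Moreover, $G'$ is graceful $k$-colorable if and only if $G$ is distance-two 4-colorable.
   Context: Graphs are finite and simple. A graceful coloring of $G$ is a function $f\colon V(G)\to\mathbb{N}$ with two properties. First, $f$ is a proper vertex coloring. Second, the labelling $h(uv)=|f(u)-f(v)|$ on edges is a proper edge coloring, meaning edges sharing an endpoint get distinct labels. A graph is graceful $k$-colorable if it has a graceful coloring with range contained in $\{1,\dots,k\}$. A distance-two $q$-coloring is a proper vertex coloring with at most $q$ colors in which, in addition, any two vertices with a common neighbour receive distinct colors. Equivalently, it is a proper $q$-coloring of the square graph. -}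

module Defs where

open import Data.Nat using (ℕ; zero; suc; _+_; _*_; _∸_; _≤_; _<_)
open import Data.Bool using (Bool; true; false; T)
open import Data.Fin using (Fin; splitAt; remQuot; toℕ)
open import Data.Fin.Properties using () renaming (_≟_ to _≟ᶠ_)
open import Data.Sum using (_⊎_; inj₁; inj₂)
open import Data.Product using (Σ; ∃; _×_; _,_; proj₁)
open import Data.List using (List; length; filter)
open import Data.List.Base using (allFin)
open import Relation.Nullary using (¬_)
open import Relation.Nullary.Decidable using (⌊_⌋)
open import Relation.Binary.PropositionalEquality using (_≡_)
open import Data.Bool.Properties using (T?)

record Graph (n : ℕ) : Set where
  field
    adj    : Fin n → Fin n → Bool
    sym    : ∀ u v → adj u v ≡ adj v u
    irrefl : ∀ v → adj v v ≡ false
open Graph public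

degree : ∀ {n} → Graph n → Fin n → ℕ
degree G v = length (filter (λ u → T? (adj G v u)) (allFin _))

Regular : ∀ {n} → ℕ → Graph n → Set
Regular d G = ∀ v → degree G v ≡ d

MaxDegree : ∀ {n} → Graph n → ℕ → Set
MaxDegree G d = (∀ v → degree G v ≤ d) × ∃ λ v → degree G v ≡ d

-- Graceful k-coloring: f : V → {1..k} (colors stored as Fin k, colour c
-- meaning toℕ c + 1; differences are unaffected by the shift).
absDiff : ℕ → ℕ → ℕ
absDiff a b = (a ∸ b) + (b ∸ a)

GracefulColoring : ∀ {n} → (k : ℕ) → Graph n → (Fin n → Fin k) → Set
GracefulColoring k G f =
  (∀ u v → T (adj G u v) → ¬ f u ≡ f v) ×
  (∀ u v w → T (adj G u v) → T (adj G u w) → ¬ v ≡ w →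
     ¬ absDiff (toℕ (f u)) (toℕ (f v)) ≡ absDiff (toℕ (f u)) (toℕ (f w)))

GracefulColorable : ∀ {n} → ℕ → Graph n → Set
GracefulColorable k G = Σ (Fin _ → Fin k) (GracefulColoring k G)

DistTwoColoring : ∀ {n} → (q : ℕ) → Graph n → (Fin n → Fin q) → Set
DistTwoColoring q G f =
  (∀ u v → T (adj G u v) → ¬ f u ≡ f v) ×
  (∀ u v w → T (adj G u v) → T (adj G u w) → ¬ v ≡ w → ¬ f v ≡ f w)

DistTwoColorable : ∀ {n} → ℕ → Graph n → Set
DistTwoColorable q G = Σ (Fin _ → Fin q) (DistTwoColoring q G)

-- Vertices of the new graph: Fin (n + n * m); the first n are the original
-- vertices, and vertex  n ↑ʳ combine i j  is the j-th leaf attached to i.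
leafAdj : ∀ {n m} → Fin n → Fin (n * m) → Bool
leafAdj {n} {m} v l = ⌊ v ≟ᶠ proj₁ (remQuot m l) ⌋

attachAdj : ∀ {n} m → Graph n → Fin (n + n * m) → Fin (n + n * m) → Bool
attachAdj {n} m G x y with splitAt n x | splitAt n y
... | inj₁ u | inj₁ v = adj G u v
... | inj₁ u | inj₂ l = leafAdj {n} {m} u l
... | inj₂ l | inj₁ v = leafAdj {n} {m} v l
... | inj₂ _ | inj₂ _ = false

attachAdj-sym : ∀ {n} m (G : Graph n) x y → attachAdj m G x y ≡ attachAdj m G y x
attachAdj-sym {n} m G x y with splitAt n x | splitAt n y
... | inj₁ u | inj₁ v = sym G u v
... | inj₁ u | inj₂ l = Relation.Binary.PropositionalEquality.refl
... | inj₂ l | inj₁ v = Relation.Binary.PropositionalEquality.refl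
... | inj₂ _ | inj₂ _ = Relation.Binary.PropositionalEquality.refl

attachAdj-irrefl : ∀ {n} m (G : Graph n) x → attachAdj m G x x ≡ false
attachAdj-irrefl {n} m G x with splitAt n x
... | inj₁ u = irrefl G u
... | inj₂ l = Relation.Binary.PropositionalEquality.refl

attachLeaves : ∀ {n} → (m : ℕ) → Graph n → Graph (n + n * m)
attachLeaves m G = record
  { adj = attachAdj m G ; sym = attachAdj-sym m G ; irrefl = attachAdj-irrefl m G }

{-# OPTIONS --safe #-}
-- Colors are 0, …, k − 1 and m = k − 5. An original vertex of G' has m + 3 edges, whose labels
-- in a graceful coloring are distinct and positive. A color x with 2 ≤ x ≤ m + 2 only allows
-- labels up to m + 2, so every original vertex is colored from the palette {0, 1, m + 3, m + 4};
-- reading the palette as four colors, equal colors at two neighbors of a vertex would give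
-- equal labels, so G is distance-two 4-colorable. Conversely, color G through the palette by a
-- distance-two 4-coloring: from each palette point the distances to the other three are
-- distinct and lie in {1, m + 2, m + 3, m + 4}, and the m leaves of a vertex take the free labels
-- 2, …, m + 1, for which there is room since the palette sits at the two ends of the range.
module Submission where

open import Defs hiding (sym)
open import Data.Nat using (ℕ; _≤_; _<_; _∸_)
open import Data.Product using (_×_)
open import Function.Bundles using (_⇔_)

open import Data.Bool using (Bool; true; false; T; if_then_else_)
open import Data.Bool.Properties using (T?)
open import Data.Empty using (⊥-elim)
open import Data.Fin as Fin
  using (Fin; zero; suc; toℕ; fromℕ<; _↑ˡ_; _↑ʳ_; splitAt; combine; remQuot; quotient; remainder)
open import Data.Fin.Patterns using (0F; 1F; 2F; 3F)
open import Data.Fin.Properties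
  using (_≟_; all?; toℕ-injective; toℕ-fromℕ<; toℕ<n; injective⇒≤; ↑ˡ-injective;
         splitAt-↑ˡ; splitAt-↑ʳ; splitAt⁻¹-↑ˡ; splitAt⁻¹-↑ʳ; remQuot-combine; combine-remQuot)
open import Data.List using (List; length; filter; tabulate; allFin; lookup)
open import Data.List.Membership.Propositional.Properties using (∈-filter⁻; ∈-lookup)
import Data.List.Relation.Unary.All as All
open import Data.List.Relation.Unary.AllPairs using (_∷_)
open import Data.List.Relation.Unary.Unique.Propositional using (Unique)
open import Data.List.Relation.Unary.Unique.Propositional.Properties using (filter⁺; allFin⁺)
open import Data.Nat using (zero; suc; pred; _+_; _*_; ∣_-_∣; z≤n; s≤s; ≢-nonZero)
open import Data.Nat.Properties as ℕ
  using (+-assoc; +-identityʳ; *-identityˡ; *-distribʳ-+; +-cancelˡ-≡; +-cancelʳ-≡;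
         ≤-refl; ≤-trans; ≤-antisym; ≤-reflexive; ≤-<-trans; ≤-pred; <⇒≤; ≰⇒>; 1+n≰n; n≤1+n;
         m≤n+m; m≤n⇒m≤o+n; m<n⇒m≤1+n; m≤n⇒m<n∨m≡n; m∸n≤m; ∸-mono; m+n∸m≡n; m∸[m∸n]≡n;
         pred-mono-<; pred-injective; ∣-∣-comm; ∣n-n∣≡0; m≡n⇒∣m-n∣≡0; ∣m-n∣≡0⇒m≡n;
         m≤n⇒∣n-m∣≡n∸m; ∣m-n∣≡[m∸n]∨[n∸m])
  renaming (_≟_ to _≟ℕ_)
open import Data.Product using (∃; _,_; proj₁; proj₂; uncurry)
open import Data.Sum using (inj₁; inj₂; [_,_]′)
open import Function using (_∘_; id)
open import Function.Bundles using (mk⇔)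
open import Function.Definitions using (Injective)
open import Relation.Nullary using (¬_; yes; no)
open import Relation.Nullary.Decidable using (does; isYes≗does; toWitness; _→-dec_)
open import Relation.Binary.PropositionalEquality

count : ∀ {n} → (Fin n → Bool) → ℕ
count {zero}  p = 0
count {suc n} p = (if p zero then 1 else 0) + count (p ∘ suc)

length-filter-tabulate : ∀ {a} {A : Set a} {n} (p : A → Bool) (f : Fin n → A) →
  length (filter (T? ∘ p) (tabulate f)) ≡ count (p ∘ f)
length-filter-tabulate {n = zero}  p f = refl
length-filter-tabulate {n = suc n} p f with p (f zero)
... | true  = cong suc (length-filter-tabulate p (f ∘ suc))
... | false = length-filter-tabulate p (f ∘ suc)

degree≡count : ∀ {n} (H : Graph n) x → degree H x ≡ count (adj H x)
degree≡count H x = length-filter-tabulate (adj H x) id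

count-cong : ∀ {n} {p q : Fin n → Bool} → (∀ i → p i ≡ q i) → count p ≡ count q
count-cong {zero}  eq = refl
count-cong {suc n} eq =
  cong₂ (λ b c → (if b then 1 else 0) + c) (eq zero) (count-cong (eq ∘ suc))

count-++ : ∀ a {b} (p : Fin (a + b) → Bool) →
  count p ≡ count (p ∘ (_↑ˡ b)) + count (p ∘ (a ↑ʳ_))
count-++ zero    p = refl
count-++ (suc a) p = trans (cong ((if p zero then 1 else 0) +_) (count-++ a (p ∘ suc)))
                           (sym (+-assoc (if p zero then 1 else 0) _ _))

count-false : ∀ n → count {n} (λ _ → false) ≡ 0
count-false zero    = refl
count-false (suc n) = count-false n

count-true : ∀ n → count {n} (λ _ → true) ≡ n
count-true zero    = refl
count-true (suc n) = cong suc (count-true n)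

count-const : ∀ n b → count {n} (λ _ → b) ≡ (if b then 1 else 0) * n
count-const n true  = trans (count-true n) (sym (*-identityˡ n))
count-const n false = count-false n

count-≟ˡ : ∀ {n} (i : Fin n) → count (λ w → does (i ≟ w)) ≡ 1
count-≟ˡ {suc n} zero    = cong suc (count-false n)
count-≟ˡ {suc n} (suc i) = count-≟ˡ i

count-≟ʳ : ∀ {n} (i : Fin n) → count (λ w → does (w ≟ i)) ≡ 1
count-≟ʳ {suc n} zero    = cong suc (count-false n)
count-≟ʳ {suc n} (suc i) = count-≟ʳ i

quotient-↑ˡ : ∀ {n} m (j : Fin m) → quotient {suc n} m (j ↑ˡ n * m) ≡ zero
quotient-↑ˡ m j = cong proj₁ (remQuot-combine zero j)

quotient-↑ʳ : ∀ {n} m (l : Fin (n * m)) → quotient {suc n} m (m ↑ʳ l) ≡ suc (quotient m l)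
quotient-↑ʳ {n} m l rewrite splitAt-↑ʳ m (n * m) l = refl

count-quotient : ∀ n {m} (p : Fin n → Bool) → count (p ∘ quotient {n} m) ≡ count p * m
count-quotient zero        p = refl
count-quotient (suc n) {m} p = begin
  count (p ∘ quotient m)
    ≡⟨ count-++ m _ ⟩
  count (λ j → p (quotient m (j ↑ˡ n * m))) + count (λ l → p (quotient m (m ↑ʳ l)))
    ≡⟨ cong₂ _+_ (count-cong (cong p ∘ quotient-↑ˡ {n} m))
                 (count-cong (cong p ∘ quotient-↑ʳ m)) ⟩
  count {m} (λ _ → p zero) + count (p ∘ Fin.suc ∘ quotient m)
    ≡⟨ cong₂ _+_ (count-const m (p zero)) (count-quotient n (p ∘ Fin.suc)) ⟩
  (if p zero then 1 else 0) * m + count (p ∘ Fin.suc) * m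
    ≡⟨ *-distribʳ-+ m (if p zero then 1 else 0) (count (p ∘ Fin.suc)) ⟨
  count p * m ∎
  where open ≡-Reasoning

absDiff≡∣-∣ : ∀ a b → absDiff a b ≡ ∣ a - b ∣
absDiff≡∣-∣ zero    zero    = refl
absDiff≡∣-∣ zero    (suc b) = refl
absDiff≡∣-∣ (suc a) zero    = +-identityʳ (suc a)
absDiff≡∣-∣ (suc a) (suc b) = absDiff≡∣-∣ a b

∣n-1+n∣≡1 : ∀ n → ∣ n - suc n ∣ ≡ 1
∣n-1+n∣≡1 zero    = refl
∣n-1+n∣≡1 (suc n) = ∣n-1+n∣≡1 n

∣m-m∸n∣≡n : ∀ {m n} → n ≤ m → ∣ m - m ∸ n ∣ ≡ n
∣m-m∸n∣≡n {m} {n} n≤m = trans (m≤n⇒∣n-m∣≡n∸m (m∸n≤m m n)) (m∸[m∸n]≡n n≤m)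

∣-∣-bounded : ∀ {c b x y} → c ≤ x → x ≤ b → y ≤ c + b → ∣ x - y ∣ ≤ b
∣-∣-bounded {c} {b} {x} {y} c≤x x≤b y≤c+b with ∣m-n∣≡[m∸n]∨[n∸m] x y
... | inj₁ eq = subst (_≤ b) (sym eq) (≤-trans (m∸n≤m x y) x≤b)
... | inj₂ eq = subst (_≤ b) (sym eq) (≤-trans (∸-mono y≤c+b c≤x) (≤-reflexive (m+n∸m≡n c b)))

injective-positive⇒≤ : ∀ {d B} (ℓ : Fin d → ℕ) → Injective _≡_ _≡_ ℓ →
  (∀ i → ℓ i ≢ 0) → (∀ i → ℓ i ≤ B) → d ≤ B
injective-positive⇒≤ {d} {B} ℓ ℓ-injective ℓ≢0 ℓ≤B = injective⇒≤ index-injective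
  where
  pred-ℓ<B : ∀ i → pred (ℓ i) < B
  pred-ℓ<B i = pred-mono-< {{≢-nonZero (ℓ≢0 i)}} (s≤s (ℓ≤B i))

  index : Fin d → Fin B
  index i = fromℕ< (pred-ℓ<B i)

  index-injective : Injective _≡_ _≡_ index
  index-injective {i} {j} eq =
    ℓ-injective (pred-injective {{≢-nonZero (ℓ≢0 i)}} {{≢-nonZero (ℓ≢0 j)}}
      (trans (sym (toℕ-fromℕ< (pred-ℓ<B i))) (trans (cong toℕ eq) (toℕ-fromℕ< (pred-ℓ<B j)))))

Unique⇒lookup-injective : ∀ {a} {A : Set a} {xs : List A} → Unique xs →
  Injective _≡_ _≡_ (lookup xs)
Unique⇒lookup-injective (_    ∷ _) {zero}  {zero}  _  = refl
Unique⇒lookup-injective (x∉xs ∷ _) {zero}  {suc j} eq = ⊥-elim (All.lookup x∉xs (∈-lookup j) eq)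
Unique⇒lookup-injective (x∉xs ∷ _) {suc i} {zero}  eq =
  ⊥-elim (All.lookup x∉xs (∈-lookup i) (sym eq))
Unique⇒lookup-injective (_    ∷ u) {suc i} {suc j} eq = cong suc (Unique⇒lookup-injective u eq)

distance : ∀ {k} → Fin k → Fin k → ℕ
distance a b = ∣ toℕ a - toℕ b ∣

module _ {N k} (H : Graph N) (f : Fin N → Fin k) where

  DistinctLabels : Set
  DistinctLabels = ∀ x y z → T (adj H x y) → T (adj H x z) → y ≢ z →
    distance (f x) (f y) ≢ distance (f x) (f z)

  graceful⇒distinctLabels : GracefulColoring k H f → DistinctLabels
  graceful⇒distinctLabels (_ , graceful) x y z xy xz y≢z eq = graceful x y z xy xz y≢z
    (trans (absDiff≡∣-∣ (toℕ (f x)) (toℕ (f y)))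
           (trans eq (sym (absDiff≡∣-∣ (toℕ (f x)) (toℕ (f z))))))

  gracefulColoring : (∀ x y → T (adj H x y) → f x ≢ f y) → DistinctLabels →
    GracefulColoring k H f
  gracefulColoring proper distinct = proper , λ x y z xy xz y≢z eq → distinct x y z xy xz y≢z
    (trans (sym (absDiff≡∣-∣ (toℕ (f x)) (toℕ (f y))))
           (trans eq (absDiff≡∣-∣ (toℕ (f x)) (toℕ (f z)))))

  graceful⇒distTwo : GracefulColoring k H f → DistTwoColoring k H f
  graceful⇒distTwo (proper , graceful) = proper , λ x y z xy xz y≢z fy≡fz →
    graceful x y z xy xz y≢z (cong (λ c → absDiff (toℕ (f x)) (toℕ c)) fy≡fz)

distTwo-pullback : ∀ {n N q r} {G : Graph n} {H : Graph N} {f : Fin N → Fin q}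
  (ι : Fin n → Fin N) → (∀ u v → T (adj G u v) → T (adj H (ι u) (ι v))) →
  Injective _≡_ _≡_ ι → DistTwoColoring q H f →
  (c : Fin n → Fin r) → (∀ u v → c u ≡ c v → f (ι u) ≡ f (ι v)) → DistTwoColoring r G c
distTwo-pullback ι hom ι-injective (proper , apart) c refines =
    (λ u v uv → proper (ι u) (ι v) (hom u v uv) ∘ refines u v)
  , (λ u v w uv uw v≢w →
       apart (ι u) (ι v) (ι w) (hom u v uv) (hom u w uw) (v≢w ∘ ι-injective) ∘ refines v w)

module _ {N} (H : Graph N) (x : Fin N) where

  neighbour : Fin (degree H x) → Fin N
  neighbour = lookup (filter (T? ∘ adj H x) (allFin N))

  neighbour-adj : ∀ i → T (adj H x (neighbour i))
  neighbour-adj i = proj₂ (∈-filter⁻ (T? ∘ adj H x) {xs = allFin N} (∈-lookup i))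

  neighbour-injective : Injective _≡_ _≡_ neighbour
  neighbour-injective = Unique⇒lookup-injective (filter⁺ (T? ∘ adj H x) (allFin⁺ N))

graceful-degree-≤ : ∀ {N k B} {H : Graph N} {f : Fin N → Fin k} → GracefulColoring k H f →
  ∀ x → (∀ y → T (adj H x y) → distance (f x) (f y) ≤ B) → degree H x ≤ B
graceful-degree-≤ {H = H} {f} graceful x bound =
  injective-positive⇒≤ label label-injective label≢0 (λ i → bound _ (neighbour-adj H x i))
  where
  label : Fin (degree H x) → ℕ
  label i = distance (f x) (f (neighbour H x i))

  label≢0 : ∀ i → label i ≢ 0
  label≢0 i eq = proj₁ graceful x _ (neighbour-adj H x i) (toℕ-injective (∣m-n∣≡0⇒m≡n eq))

  label-injective : Injective _≡_ _≡_ label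
  label-injective {i} {j} eq with neighbour H x i ≟ neighbour H x j
  ... | yes same      = neighbour-injective H x same
  ... | no  different = ⊥-elim (graceful⇒distinctLabels H f graceful x _ _
                                  (neighbour-adj H x i) (neighbour-adj H x j) different eq)

module AttachLeaves {n : ℕ} (m : ℕ) (G : Graph n) where

  G⁺ : Graph (n + n * m)
  G⁺ = attachLeaves m G

  orig : Fin n → Fin (n + n * m)
  orig u = u ↑ˡ n * m

  leaf : Fin n → Fin m → Fin (n + n * m)
  leaf u j = n ↑ʳ combine u j

  orig-injective : Injective _≡_ _≡_ orig
  orig-injective = ↑ˡ-injective (n * m) _ _

  data View : Fin (n + n * m) → Set where
    orig-view : ∀ u → View (orig u)
    leaf-view : ∀ u j → View (leaf u j)

  view : ∀ x → View x
  view x with splitAt n x in eq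
  ... | inj₁ u = subst View (splitAt⁻¹-↑ˡ eq) (orig-view u)
  ... | inj₂ l = subst View (trans (cong (n ↑ʳ_) (combine-remQuot {n} m l)) (splitAt⁻¹-↑ʳ eq))
                            (leaf-view (quotient m l) (remainder {n} m l))

  adj-orig-orig : ∀ u v → adj G⁺ (orig u) (orig v) ≡ adj G u v
  adj-orig-orig u v rewrite splitAt-↑ˡ n u (n * m) | splitAt-↑ˡ n v (n * m) = refl

  adj-orig-↑ʳ : ∀ u l → adj G⁺ (orig u) (n ↑ʳ l) ≡ does (u ≟ quotient m l)
  adj-orig-↑ʳ u l rewrite splitAt-↑ˡ n u (n * m) | splitAt-↑ʳ n (n * m) l =
    isYes≗does (u ≟ quotient m l)

  adj-↑ʳ-↑ʳ : ∀ l l′ → adj G⁺ (n ↑ʳ l) (n ↑ʳ l′) ≡ false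
  adj-↑ʳ-↑ʳ l l′ rewrite splitAt-↑ʳ n (n * m) l | splitAt-↑ʳ n (n * m) l′ = refl

  adj-orig-leaf : ∀ u v j → adj G⁺ (orig u) (leaf v j) ≡ does (u ≟ v)
  adj-orig-leaf u v j = trans (adj-orig-↑ʳ u (combine v j))
                              (cong (λ w → does (u ≟ w)) (cong proj₁ (remQuot-combine v j)))

  adj-leaf-orig : ∀ u j v → adj G⁺ (leaf u j) (orig v) ≡ does (v ≟ u)
  adj-leaf-orig u j v = trans (Graph.sym G⁺ (leaf u j) (orig v)) (adj-orig-leaf v u j)

  degree-orig : ∀ u → degree G⁺ (orig u) ≡ degree G u + m
  degree-orig u = begin
    degree G⁺ (orig u)
      ≡⟨ degree≡count G⁺ (orig u) ⟩
    count (adj G⁺ (orig u))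
      ≡⟨ count-++ n _ ⟩
    count (adj G⁺ (orig u) ∘ orig) + count (adj G⁺ (orig u) ∘ (n ↑ʳ_))
      ≡⟨ cong₂ _+_ (count-cong (adj-orig-orig u)) (count-cong (adj-orig-↑ʳ u)) ⟩
    count (adj G u) + count (λ l → does (u ≟ quotient m l))
      ≡⟨ cong₂ _+_ (sym (degree≡count G u)) (count-quotient n (λ w → does (u ≟ w))) ⟩
    degree G u + count (λ w → does (u ≟ w)) * m
      ≡⟨ cong (λ c → degree G u + c * m) (count-≟ˡ u) ⟩
    degree G u + 1 * m
      ≡⟨ cong (degree G u +_) (*-identityˡ m) ⟩
    degree G u + m ∎
    where open ≡-Reasoning

  degree-leaf : ∀ u j → degree G⁺ (leaf u j) ≡ 1
  degree-leaf u j = begin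
    degree G⁺ (leaf u j)
      ≡⟨ degree≡count G⁺ (leaf u j) ⟩
    count (adj G⁺ (leaf u j))
      ≡⟨ count-++ n _ ⟩
    count (adj G⁺ (leaf u j) ∘ orig) + count (adj G⁺ (leaf u j) ∘ (n ↑ʳ_))
      ≡⟨ cong₂ _+_ (count-cong (adj-leaf-orig u j)) (count-cong (adj-↑ʳ-↑ʳ (combine u j))) ⟩
    count (λ v → does (v ≟ u)) + count {n * m} (λ _ → false)
      ≡⟨ cong₂ _+_ (count-≟ʳ u) (count-false (n * m)) ⟩
    1 ∎
    where open ≡-Reasoning

  maxDegree : ∀ {d} → 0 < n → 1 ≤ d + m → Regular d G → MaxDegree G⁺ (d + m)
  maxDegree {d} 0<n 1≤d+m regular =
    degree-≤ , orig (fromℕ< 0<n) , degree-orig-regular (fromℕ< 0<n)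
    where
    degree-orig-regular : ∀ u → degree G⁺ (orig u) ≡ d + m
    degree-orig-regular u = trans (degree-orig u) (cong (_+ m) (regular u))

    degree-≤ : ∀ x → degree G⁺ x ≤ d + m
    degree-≤ x with view x
    ... | orig-view u   = ≤-reflexive (degree-orig-regular u)
    ... | leaf-view u j = subst (_≤ d + m) (sym (degree-leaf u j)) 1≤d+m

  neighbour-of-leaf : ∀ u j y → T (adj G⁺ (leaf u j) y) → y ≡ orig u
  neighbour-of-leaf u j y uy with view y
  ... | orig-view v    = cong orig (toWitness {a? = v ≟ u}
          (subst T (trans (adj-leaf-orig u j v) (sym (isYes≗does (v ≟ u)))) uy))
  ... | leaf-view v j′ = ⊥-elim (subst T (adj-↑ʳ-↑ʳ (combine u j) (combine v j′)) uy)

  data OrigNeighbour (u : Fin n) : Fin (n + n * m) → Set where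
    original : ∀ {v} → T (adj G u v) → OrigNeighbour u (orig v)
    pendant  : ∀ j → OrigNeighbour u (leaf u j)

  neighbour-of-orig : ∀ u y → T (adj G⁺ (orig u) y) → OrigNeighbour u y
  neighbour-of-orig u y uy with view y
  ... | orig-view v = original (subst T (adj-orig-orig u v) uy)
  ... | leaf-view v j with toWitness {a? = u ≟ v}
                             (subst T (trans (adj-orig-leaf u v j) (sym (isYes≗does (u ≟ v)))) uy)
  ...   | refl = pendant j

  module _ {k} (g : Fin n → Fin k) (h : Fin n → Fin m → Fin k) where

    extend : Fin (n + n * m) → Fin k
    extend x = [ g , uncurry h ∘ remQuot {n} m ]′ (splitAt n x)

    extend-orig : ∀ u → extend (orig u) ≡ g u
    extend-orig u = cong [ g , _ ]′ (splitAt-↑ˡ n u (n * m))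

    extend-leaf : ∀ u j → extend (leaf u j) ≡ h u j
    extend-leaf u j = trans (cong [ g , _ ]′ (splitAt-↑ʳ n (n * m) (combine u j)))
                            (cong (uncurry h) (remQuot-combine u j))

    extend-graceful : GracefulColoring k G g →
      (ℓ : Fin m → ℕ) → Injective _≡_ _≡_ ℓ → (∀ j → ℓ j ≢ 0) →
      (∀ u j → distance (g u) (h u j) ≡ ℓ j) →
      (∀ u v j → T (adj G u v) → distance (g u) (g v) ≢ ℓ j) →
      GracefulColoring k G⁺ extend
    extend-graceful g-graceful ℓ ℓ-injective ℓ≢0 pendant-label edge-label≢ =
      gracefulColoring G⁺ extend proper distinct
      where
      label : ∀ {u y} → OrigNeighbour u y → ℕ
      label {u} (original {v} _) = distance (g u) (g v)
      label     (pendant j)      = ℓ j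

      label-orig : ∀ {u y} (p : OrigNeighbour u y) → distance (extend (orig u)) (extend y) ≡ label p
      label-orig {u} (original {v} _) = cong₂ distance (extend-orig u) (extend-orig v)
      label-orig {u} (pendant j)      =
        trans (cong₂ distance (extend-orig u) (extend-leaf u j)) (pendant-label u j)

      label≢0 : ∀ {u y} (p : OrigNeighbour u y) → label p ≢ 0
      label≢0 (original uv) eq = proj₁ g-graceful _ _ uv (toℕ-injective (∣m-n∣≡0⇒m≡n eq))
      label≢0 (pendant j)      = ℓ≢0 j

      label-distinct : ∀ {u y z} (p : OrigNeighbour u y) (q : OrigNeighbour u z) → y ≢ z →
        label p ≢ label q
      label-distinct (original uv) (original uw) y≢z =
        graceful⇒distinctLabels G g g-graceful _ _ _ uv uw (y≢z ∘ cong orig)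
      label-distinct (original uv) (pendant j)   _   = edge-label≢ _ _ j uv
      label-distinct (pendant j)   (original uw) _   = edge-label≢ _ _ j uw ∘ sym
      label-distinct (pendant j)   (pendant j′)  y≢z = y≢z ∘ cong (leaf _) ∘ ℓ-injective

      proper-orig : ∀ u y → T (adj G⁺ (orig u) y) → extend (orig u) ≢ extend y
      proper-orig u y uy eq = label≢0 p (trans (sym (label-orig p)) (m≡n⇒∣m-n∣≡0 (cong toℕ eq)))
        where p = neighbour-of-orig u y uy

      proper : ∀ x y → T (adj G⁺ x y) → extend x ≢ extend y
      proper x y xy with view x
      ... | orig-view u = proper-orig u y xy
      ... | leaf-view u j with neighbour-of-leaf u j y xy
      ...   | refl = proper-orig u (leaf u j) (subst T (Graph.sym G⁺ _ _) xy) ∘ sym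

      distinct : DistinctLabels G⁺ extend
      distinct x y z xy xz y≢z with view x
      ... | orig-view u = λ eq →
              label-distinct p q y≢z (trans (sym (label-orig p)) (trans eq (label-orig q)))
        where p = neighbour-of-orig u y xy
              q = neighbour-of-orig u z xz
      ... | leaf-view u j =
              ⊥-elim (y≢z (trans (neighbour-of-leaf u j y xy) (sym (neighbour-of-leaf u j z xz))))

-- palette m = {0, 1, m + 3, m + 4} is the palette {0, 1, 3, 4} of the case m = 0 stretched by m
-- above 1, and so are its distances (∣-∣-palette); the remaining facts about the m = 0 palette
-- are decided by evaluation.
module Palette (m : ℕ) where

  stretch : ℕ → ℕ
  stretch 0             = 0
  stretch 1             = 1
  stretch (suc (suc i)) = 2 + (i + m)

  palette₀ : Fin 4 → ℕ
  palette₀ 0F = 0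
  palette₀ 1F = 1
  palette₀ 2F = 3
  palette₀ 3F = 4

  palette : Fin 4 → ℕ
  palette = stretch ∘ palette₀

  stretch-injective : Injective _≡_ _≡_ stretch
  stretch-injective {0}           {0}           _  = refl
  stretch-injective {1}           {1}           _  = refl
  stretch-injective {suc (suc i)} {suc (suc j)} eq =
    cong (2 +_) (+-cancelʳ-≡ m i j (+-cancelˡ-≡ 2 _ _ eq))
  stretch-injective {0}           {1}           ()
  stretch-injective {0}           {suc (suc _)} ()
  stretch-injective {1}           {0}           ()
  stretch-injective {1}           {suc (suc _)} ()
  stretch-injective {suc (suc _)} {0}           ()
  stretch-injective {suc (suc _)} {1}           ()

  ∣-∣-palette : ∀ a b → ∣ palette a - palette b ∣ ≡ stretch ∣ palette₀ a - palette₀ b ∣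
  ∣-∣-palette 0F b  = refl
  ∣-∣-palette 1F 0F = refl
  ∣-∣-palette 1F 1F = refl
  ∣-∣-palette 1F 2F = refl
  ∣-∣-palette 1F 3F = refl
  ∣-∣-palette 2F 0F = refl
  ∣-∣-palette 2F 1F = refl
  ∣-∣-palette 2F 2F = ∣n-n∣≡0 m
  ∣-∣-palette 2F 3F = ∣n-1+n∣≡1 m
  ∣-∣-palette 3F 0F = refl
  ∣-∣-palette 3F 1F = refl
  ∣-∣-palette 3F 2F = trans (∣-∣-comm (suc m) m) (∣n-1+n∣≡1 m)
  ∣-∣-palette 3F 3F = ∣n-n∣≡0 m

  palette₀-distances-injective : ∀ a b c →
    ∣ palette₀ a - palette₀ b ∣ ≡ ∣ palette₀ a - palette₀ c ∣ → b ≡ c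
  palette₀-distances-injective = toWitness {a? = all? λ a → all? λ b → all? λ c →
    (∣ palette₀ a - palette₀ b ∣ ≟ℕ ∣ palette₀ a - palette₀ c ∣) →-dec (b ≟ c)} _

  palette-distances-injective : ∀ a {b c} →
    ∣ palette a - palette b ∣ ≡ ∣ palette a - palette c ∣ → b ≡ c
  palette-distances-injective a {b} {c} eq = palette₀-distances-injective a b c
    (stretch-injective (trans (sym (∣-∣-palette a b)) (trans eq (∣-∣-palette a c))))

  palette-injective : Injective _≡_ _≡_ palette
  palette-injective {a} eq =
    palette-distances-injective a (trans (∣n-n∣≡0 (palette a)) (sym (m≡n⇒∣m-n∣≡0 eq)))

  palette-distance≢ : ∀ {a b t} → a ≢ b → t < m → ∣ palette a - palette b ∣ ≢ 2 + t
  palette-distance≢ {a} {b} {t} a≢b t<m rewrite ∣-∣-palette a b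
    with ∣ palette₀ a - palette₀ b ∣ in eq
  ... | 0           = λ _ → a≢b (palette₀-distances-injective a a b
                                   (trans (∣n-n∣≡0 (palette₀ a)) (sym eq)))
  ... | 1           = λ ()
  ... | suc (suc i) = λ i+m≡t →
          1+n≰n (≤-trans t<m (subst (m ≤_) (+-cancelˡ-≡ 2 _ _ i+m≡t) (m≤n+m m i)))

  palette<5+m : ∀ a → palette a < 5 + m
  palette<5+m 0F = s≤s z≤n
  palette<5+m 1F = s≤s (s≤s z≤n)
  palette<5+m 2F = s≤s (s≤s (s≤s (s≤s (n≤1+n m))))
  palette<5+m 3F = ≤-refl

  embed : Fin 4 → Fin (5 + m)
  embed a = fromℕ< (palette<5+m a)

  embed-injective : Injective _≡_ _≡_ embed
  embed-injective {a} {b} eq = palette-injective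
    (trans (sym (toℕ-fromℕ< (palette<5+m a))) (trans (cong toℕ eq) (toℕ-fromℕ< (palette<5+m b))))

  distance-embed : ∀ a b → distance (embed a) (embed b) ≡ ∣ palette a - palette b ∣
  distance-embed a b = cong₂ ∣_-_∣ (toℕ-fromℕ< (palette<5+m a)) (toℕ-fromℕ< (palette<5+m b))

  room-below : ∀ a t → 2 + t ≤ palette a → ∃ λ y → y < 5 + m × ∣ palette a - y ∣ ≡ 2 + t
  room-below a t le =
    palette a ∸ (2 + t) , ≤-<-trans (m∸n≤m (palette a) (2 + t)) (palette<5+m a) , ∣m-m∸n∣≡n le

  room : ∀ a t → t < m → ∃ λ y → y < 5 + m × ∣ palette a - y ∣ ≡ 2 + t
  room 0F t t<m = 2 + t , s≤s (s≤s (m≤n⇒m≤o+n 3 t<m)) , refl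
  room 1F t t<m = 3 + t , s≤s (s≤s (s≤s (m≤n⇒m≤o+n 2 t<m))) , refl
  room 2F t t<m = room-below 2F t (s≤s (s≤s (m<n⇒m≤1+n t<m)))
  room 3F t t<m = room-below 3F t (s≤s (s≤s (m≤n⇒m≤o+n 2 (<⇒≤ t<m))))

  palette-complete : ∀ x → x < 5 + m → ¬ (2 ≤ x × x ≤ 2 + m) → ∃ λ a → palette a ≡ x
  palette-complete 0 _ _ = 0F , refl
  palette-complete 1 _ _ = 1F , refl
  palette-complete (suc (suc y)) (s≤s (s≤s (s≤s y≤2+m))) not-middle
    with m≤n⇒m<n∨m≡n y≤2+m
  ... | inj₁ (s≤s y≤1+m) = 2F , cong (2 +_) (≤-antisym m<y y≤1+m)
    where m<y = ≰⇒> λ y≤m → not-middle (s≤s (s≤s z≤n) , s≤s (s≤s y≤m))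
  ... | inj₂ refl        = 3F , refl

module _ (m : ℕ) {n} (G : Graph n) where
  open AttachLeaves m G
  open Palette m

  palette-graceful : ∀ {c} → DistTwoColoring 4 G c → GracefulColoring (5 + m) G (embed ∘ c)
  palette-graceful {c} (proper , apart) = gracefulColoring G (embed ∘ c)
    (λ u v uv → proper u v uv ∘ embed-injective)
    (λ u v w uv uw v≢w eq → apart u v w uv uw v≢w (palette-distances-injective (c u)
      (trans (sym (distance-embed (c u) (c v))) (trans eq (distance-embed (c u) (c w))))))

  distTwoColorable⇒gracefulColorable : DistTwoColorable 4 G → GracefulColorable (5 + m) G⁺
  distTwoColorable⇒gracefulColorable (c , distTwo) =
    extend g h , extend-graceful g h (palette-graceful distTwo)
                   (λ j → 2 + toℕ j) (toℕ-injective ∘ +-cancelˡ-≡ 2 _ _) (λ _ ())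
                   pendant-label edge-label≢
    where
    g : Fin n → Fin (5 + m)
    g = embed ∘ c

    pendant-color : ∀ u (j : Fin m) → ∃ λ y → y < 5 + m × ∣ palette (c u) - y ∣ ≡ 2 + toℕ j
    pendant-color u j = room (c u) (toℕ j) (toℕ<n j)

    h : Fin n → Fin m → Fin (5 + m)
    h u j = fromℕ< (proj₁ (proj₂ (pendant-color u j)))

    pendant-label : ∀ u j → distance (g u) (h u j) ≡ 2 + toℕ j
    pendant-label u j = trans (cong₂ ∣_-_∣ (toℕ-fromℕ< (palette<5+m (c u))) (toℕ-fromℕ< _))
                              (proj₂ (proj₂ (pendant-color u j)))

    edge-label≢ : ∀ u v j → T (adj G u v) → distance (g u) (g v) ≢ 2 + toℕ j
    edge-label≢ u v j uv = palette-distance≢ (proj₁ distTwo u v uv) (toℕ<n j)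
                         ∘ trans (sym (distance-embed (c u) (c v)))

  orig-color-in-palette : Regular 3 G → ∀ {f} → GracefulColoring (5 + m) G⁺ f →
    ∀ u → ∃ λ a → palette a ≡ toℕ (f (orig u))
  orig-color-in-palette regular {f} graceful u =
    palette-complete x (toℕ<n (f (orig u))) not-middle
    where
    x : ℕ
    x = toℕ (f (orig u))

    not-middle : ¬ (2 ≤ x × x ≤ 2 + m)
    not-middle (2≤x , x≤2+m) = 1+n≰n (begin
      3 + m              ≡⟨ trans (degree-orig u) (cong (_+ m) (regular u)) ⟨
      degree G⁺ (orig u) ≤⟨ graceful-degree-≤ {H = G⁺} graceful (orig u)
                              (λ y _ → ∣-∣-bounded 2≤x x≤2+m (≤-pred (toℕ<n (f y)))) ⟩
      2 + m              ∎)
      where open ℕ.≤-Reasoning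

  gracefulColorable⇒distTwoColorable : Regular 3 G →
    GracefulColorable (5 + m) G⁺ → DistTwoColorable 4 G
  gracefulColorable⇒distTwoColorable regular (f , graceful) =
    c , distTwo-pullback {G = G} {H = G⁺} orig (λ u v → subst T (sym (adj-orig-orig u v)))
                         orig-injective (graceful⇒distTwo G⁺ f graceful) c same-color
    where
    in-palette : ∀ u → ∃ λ a → palette a ≡ toℕ (f (orig u))
    in-palette = orig-color-in-palette regular graceful

    c : Fin n → Fin 4
    c u = proj₁ (in-palette u)

    same-color : ∀ u v → c u ≡ c v → f (orig u) ≡ f (orig v)
    same-color u v eq = toℕ-injective
      (trans (sym (proj₂ (in-palette u))) (trans (cong palette eq) (proj₂ (in-palette v))))

mainTheorem3 : (k : ℕ) → 5 ≤ k → (n : ℕ) → 0 < n → (G : Graph n) → Regular 3 G →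
    MaxDegree (attachLeaves (k ∸ 5) G) (k ∸ 2) ×
    (GracefulColorable k (attachLeaves (k ∸ 5) G) ⇔ DistTwoColorable 4 G)
-- For k = 5 + m, k ∸ 5 and k ∸ 2 reduce to m and 3 + m.
mainTheorem3 _ (s≤s (s≤s (s≤s (s≤s (s≤s {n = m} z≤n))))) n 0<n G regular =
    maxDegree 0<n (s≤s z≤n) regular
  , mk⇔ (gracefulColorable⇒distTwoColorable m G regular) (distTwoColorable⇒gracefulColorable m G)
  where open AttachLeaves m G using (maxDegree)
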